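{- For integers $n\ge1$ and $k\ge0$, the number of $321$-avoiding permutations of length $n+k$ whose $k$ largest entries $n+1,\dots,n+k$ are all LTR maxima equals \[\sum_{i=0}^{n-1}\left(\!\binom{n-i+1}{k}\!\right)b_{n,i+1}.\]
   Context: A permutation $\pi=\pi_1\cdots\pi_N$ of $\{1,\dots,N\}$ is $321$-avoiding if there are no $a<b<c$ with $\pi_a>\pi_b>\pi_c$; $S_N(321)$ denotes the set of these. An entry $\pi_i$ is a left-to-right (LTR) maximum if $\pi_i>\pi_j$ for all $j<i$. For $n\ge1$, $1\le i\le n$, $b_{n,i}=|\{\pi\in S_n(321):\pi_i=n\}|$. $\left(\!\binom{u}{v}\!\right)=\binom{u+v-1}{v}$ is the number of multisets of size $v$ over a set of size $u$. -}

module Defs where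

open import Data.Nat as ℕ using (ℕ; zero; suc; _+_; _*_; _∸_; _≤_)
open import Data.Nat.Combinatorics using (_C_)
open import Data.Fin as F using (Fin; toℕ)
open import Data.Fin.Properties using (_≟_; _<?_; all?; any?)
import Data.Nat.Properties as ℕP
open import Data.Vec using (Vec; []; _∷_; lookup)
open import Data.List using (List; [_]; concatMap; map; filter; length; allFin)
open import Data.Product using (Σ; _×_; _,_)
open import Relation.Nullary using (¬_; Dec)
open import Relation.Nullary.Decidable using (_×-dec_; _→-dec_; ¬?)
open import Relation.Binary.PropositionalEquality using (_≡_)

-- Words of length m over the alphabet Fin N (0-indexed positions and values;
-- value v : Fin N stands for the integer toℕ v + 1).
allWords : (m N : ℕ) → List (Vec (Fin N) m)
allWords zero    N = [ [] ]
allWords (suc m) N = concatMap (λ x → map (x ∷_) (allWords m N)) (allFin N)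

IsPerm : ∀ {N} → Vec (Fin N) N → Set
IsPerm v = ∀ i j → lookup v i ≡ lookup v j → i ≡ j

Avoids321 : ∀ {N} → Vec (Fin N) N → Set
Avoids321 v = ∀ a b c → a F.< b → b F.< c →
  ¬ (lookup v c F.< lookup v b × lookup v b F.< lookup v a)

IsLTRMax : ∀ {N} → Vec (Fin N) N → Fin N → Set
IsLTRMax v i = ∀ j → j F.< i → lookup v j F.< lookup v i

-- The entries n+1,…,n+k (0-indexed values ≥ n) are all LTR maxima.
LargestAreLTRMax : (n : ℕ) → ∀ {N} → Vec (Fin N) N → Set
LargestAreLTRMax n v = ∀ i → n ≤ toℕ (lookup v i) → IsLTRMax v i

-- π_i = n  (i is 1-based as in the paper, n = length).
MaxAt : (n i : ℕ) → Vec (Fin n) n → Set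
MaxAt n i v = Σ (Fin n) λ p → suc (toℕ p) ≡ i × suc (toℕ (lookup v p)) ≡ n

isPerm? : ∀ {N} (v : Vec (Fin N) N) → Dec (IsPerm v)
isPerm? v = all? λ i → all? λ j → (lookup v i ≟ lookup v j) →-dec (i ≟ j)

avoids321? : ∀ {N} (v : Vec (Fin N) N) → Dec (Avoids321 v)
avoids321? v = all? λ a → all? λ b → all? λ c →
  (a <? b) →-dec (b <? c) →-dec
  ¬? ((lookup v c <? lookup v b) ×-dec (lookup v b <? lookup v a))

isLTRMax? : ∀ {N} (v : Vec (Fin N) N) i → Dec (IsLTRMax v i)
isLTRMax? v i = all? λ j → (j <? i) →-dec (lookup v j <? lookup v i)

largestAreLTRMax? : ∀ n {N} (v : Vec (Fin N) N) → Dec (LargestAreLTRMax n v)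
largestAreLTRMax? n v = all? λ i → (n ℕP.≤? toℕ (lookup v i)) →-dec isLTRMax? v i

maxAt? : ∀ n i (v : Vec (Fin n) n) → Dec (MaxAt n i v)
maxAt? n i v = any? λ p → (suc (toℕ p) ℕP.≟ i) ×-dec (suc (toℕ (lookup v p)) ℕP.≟ n)

countLTR : (n k : ℕ) → ℕ
countLTR n k = length (filter
  (λ v → isPerm? v ×-dec avoids321? v ×-dec largestAreLTRMax? n v)
  (allWords (n + k) (n + k)))

b : (n i : ℕ) → ℕ
b n i = length (filter
  (λ v → isPerm? v ×-dec avoids321? v ×-dec maxAt? n i v)
  (allWords n n))

multichoose : ℕ → ℕ → ℕ
multichoose u v = (u + v ∸ 1) C v

sumBelow : ℕ → (ℕ → ℕ) → ℕ
sumBelow zero    f = 0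
sumBelow (suc m) f = sumBelow m f + f m

module Submission where

open import Defs
open import Data.Nat using (ℕ; _+_; _*_; _∸_; _≤_)
open import Relation.Binary.PropositionalEquality using (_≡_)

open import Data.Empty using (⊥-elim)
open import Data.Fin as F using (Fin; toℕ; fromℕ; inject₁; lower₁; punchIn)
import Data.Fin.Properties as FP
open import Data.List as L using (List; []; _∷_; length; filter; concatMap; cartesianProductWith)
open import Data.List.Membership.Propositional using (_∈_)
import Data.List.Membership.Propositional.Properties as ∈
open import Data.List.Membership.Propositional.Properties.WithK using (unique∧set⇒bag)
import Data.List.Properties as LP
open import Data.List.Relation.Binary.BagAndSetEquality using (_∼[_]_; set; ∼bag⇒↭)
open import Data.List.Relation.Binary.Permutation.Propositional.Properties using (↭-length)
import Data.List.Relation.Unary.All as All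
open import Data.List.Relation.Unary.AllPairs using ([]; _∷_)
open import Data.List.Relation.Unary.Any using (here)
open import Data.List.Relation.Unary.Unique.Propositional using (Unique)
import Data.List.Relation.Unary.Unique.Propositional.Properties as Unique
open import Data.Nat as ℕ using (zero; suc; _<_; z≤n; s≤s; s≤s⁻¹)
open import Data.Nat.Combinatorics using (_C_; nCn≡1; nCk+nC[k+1]≡[n+1]C[k+1])
import Data.Nat.Properties as ℕP
open import Algebra.Properties.CommutativeSemigroup ℕP.+-commutativeSemigroup using (interchange)
open import Data.Product using (_×_; _,_; proj₁; proj₂; ∃-syntax)
open import Data.Sum using (inj₁; inj₂)
open import Data.Vec as V using (Vec; lookup; tabulate)
import Data.Vec.Properties as VP
open import Data.Vec.Relation.Binary.Pointwise.Extensional using (ext; Pointwise-≡⇒≡)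
open import Function using (_∘_)
open import Function.Bundles using (mk⇔)
open import Function.Definitions using (Injective)
open import Level using (0ℓ)
open import Relation.Binary.PropositionalEquality
  using (_≢_; refl; sym; trans; cong; cong₂; subst; subst₂; module ≡-Reasoning)
open import Relation.Nullary using (¬_; yes; no; _→-dec_; ¬?)
open import Relation.Unary using (Pred; Decidable; _∩_; ∁; _≐_)
open import Relation.Unary.Properties using (_∩?_; ∁?)
open ≡-Reasoning

-- Call an entry large if it exceeds n, and let T(N, h) = countRefined n N h be the number of
-- π ∈ S_N(321) whose large entries are LTR maxima and all sit in the first h positions, and
-- which increase from position h on (positions counted from 0).  For N ≥ n the maximum N + 1
-- of such a permutation of length N + 1 is large, so it sits at some position g < h, and
-- deleting it leaves a permutation counted by T(N, g): inserting the maximum at g creates a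
-- 321 exactly when a descent follows g, and keeps the large entries LTR maxima exactly when
-- they all precede g.  Hence T(N + 1, h) = Σ_{g<h} T(N, g).  In length n nothing is large,
-- and the same deletion gives T(n, d) = Σ_{p≤d} b_{n,p+1} for d ≤ n.  Pascal's rule for
-- multiset coefficients solves this recursion,
--   T(n + k, d + k) = Σ_{p≤d} ((d − p + 1, k)) b_{n,p+1},
-- and for d = n the side conditions on T are vacuous while b_{n,n+1} = 0.

sumBelow-cong : ∀ B {f g : ℕ → ℕ} → (∀ p → p < B → f p ≡ g p) → sumBelow B f ≡ sumBelow B g
sumBelow-cong zero    f≗g = refl
sumBelow-cong (suc B) f≗g =
  cong₂ _+_ (sumBelow-cong B (λ p p<B → f≗g p (ℕP.m<n⇒m<1+n p<B))) (f≗g B (ℕP.n<1+n B))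

sumBelow-+ : ∀ B (f g : ℕ → ℕ) → sumBelow B (λ p → f p + g p) ≡ sumBelow B f + sumBelow B g
sumBelow-+ zero    f g = refl
sumBelow-+ (suc B) f g =
  trans (cong (_+ (f B + g B)) (sumBelow-+ B f g)) (interchange (sumBelow B f) (sumBelow B g) (f B) (g B))

sumBelow-0 : ∀ B {f : ℕ → ℕ} → (∀ p → p < B → f p ≡ 0) → sumBelow B f ≡ 0
sumBelow-0 zero    f≡0 = refl
sumBelow-0 (suc B) f≡0 =
  cong₂ _+_ (sumBelow-0 B (λ p p<B → f≡0 p (ℕP.m<n⇒m<1+n p<B))) (f≡0 B (ℕP.n<1+n B))

sumBelow-++ : ∀ a b (f : ℕ → ℕ) → sumBelow (a + b) f ≡ sumBelow a f + sumBelow b (λ i → f (a + i))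
sumBelow-++ a zero    f = trans (cong (λ x → sumBelow x f) (ℕP.+-identityʳ a)) (sym (ℕP.+-identityʳ _))
sumBelow-++ a (suc b) f = begin
  sumBelow (a + suc b) f                                   ≡⟨ cong (λ x → sumBelow x f) (ℕP.+-suc a b) ⟩
  sumBelow (a + b) f + f (a + b)                           ≡⟨ cong (_+ f (a + b)) (sumBelow-++ a b f) ⟩
  sumBelow a f + sumBelow b (λ i → f (a + i)) + f (a + b)  ≡⟨ ℕP.+-assoc (sumBelow a f) _ _ ⟩
  sumBelow a f + sumBelow (suc b) (λ i → f (a + i))        ∎

sumBelow-truncate : ∀ h B {f g : ℕ → ℕ} → h ≤ B → (∀ p → p < h → f p ≡ g p) →
  (∀ p → h ≤ p → p < B → f p ≡ 0) → sumBelow B f ≡ sumBelow h g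
sumBelow-truncate h B {f} {g} h≤B f≗g f≡0 = begin
  sumBelow B f
    ≡⟨ cong (λ x → sumBelow x f) (sym (ℕP.m+[n∸m]≡n h≤B)) ⟩
  sumBelow (h + (B ∸ h)) f
    ≡⟨ sumBelow-++ h (B ∸ h) f ⟩
  sumBelow h f + sumBelow (B ∸ h) (λ i → f (h + i))
    ≡⟨ cong₂ _+_ (sumBelow-cong h f≗g) (sumBelow-0 (B ∸ h) tail≡0) ⟩
  sumBelow h g + 0
    ≡⟨ ℕP.+-identityʳ _ ⟩
  sumBelow h g ∎
  where
  tail≡0 : ∀ i → i < B ∸ h → f (h + i) ≡ 0
  tail≡0 i i<B∸h = f≡0 (h + i) (ℕP.m≤m+n h i)
    (subst (h + i <_) (ℕP.m+[n∸m]≡n h≤B) (ℕP.+-monoʳ-< h i<B∸h))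

multichoose-1 : ∀ k → multichoose 1 k ≡ 1
multichoose-1 = nCn≡1

multichoose-pascal : ∀ u k →
  multichoose (2 + u) (1 + k) ≡ multichoose (1 + u) (1 + k) + multichoose (2 + u) k
multichoose-pascal u k = begin
  (suc u + suc k) C suc k                ≡⟨ cong (_C suc k) (ℕP.+-suc (suc u) k) ⟩
  suc (suc u + k) C suc k                ≡⟨ sym (nCk+nC[k+1]≡[n+1]C[k+1] (suc u + k) k) ⟩
  (suc u + k) C k + (suc u + k) C suc k  ≡⟨ ℕP.+-comm ((suc u + k) C k) _ ⟩
  (suc u + k) C suc k + (suc u + k) C k  ≡⟨ cong (λ x → x C suc k + (suc u + k) C k) (sym (ℕP.+-suc u k)) ⟩
  (u + suc k) C suc k + (suc u + k) C k  ∎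

module Recurrence (n : ℕ) (T : ℕ → ℕ → ℕ) (β : ℕ → ℕ)
  (T-suc : ∀ N h → n ≤ N → h ≤ suc N → T (suc N) h ≡ sumBelow h (T N))
  (T-base : ∀ d → d ≤ n → T n d ≡ sumBelow (suc d) β) where

  solution : ℕ → ℕ → ℕ
  solution k d = sumBelow (suc d) λ p → β p * multichoose (suc (d ∸ p)) k

  T-vanishes : ∀ k h → h < k → T (n + k) h ≡ 0
  T-vanishes (suc k) h h<1+k = begin
    T (n + suc k) h         ≡⟨ cong (λ N → T N h) (ℕP.+-suc n k) ⟩
    T (suc (n + k)) h       ≡⟨ T-suc (n + k) h (ℕP.m≤m+n n k) (ℕP.m≤n⇒m≤1+n (ℕP.m≤n⇒m≤o+n n h≤k)) ⟩
    sumBelow h (T (n + k))  ≡⟨ sumBelow-0 h (λ p p<h → T-vanishes k p (ℕP.<-≤-trans p<h h≤k)) ⟩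
    0                       ∎
    where
    h≤k : h ≤ k
    h≤k = s≤s⁻¹ h<1+k

  pascal-term : ∀ k d p → p ≤ d → multichoose (suc (suc d ∸ p)) (suc k)
    ≡ multichoose (suc (d ∸ p)) (suc k) + multichoose (suc (suc d ∸ p)) k
  pascal-term k d p p≤d rewrite ℕP.+-∸-assoc 1 p≤d = multichoose-pascal (d ∸ p) k

  solution-suc : ∀ k d → sumBelow (suc d) (solution k) ≡ solution (suc k) d
  solution-suc k zero = cong (β 0 *_) (trans (multichoose-1 k) (sym (multichoose-1 (suc k))))
  solution-suc k (suc d) = begin
    sumBelow (suc d) (solution k) + solution k (suc d)
      ≡⟨ cong (_+ solution k (suc d)) (solution-suc k d) ⟩
    solution (suc k) d + (shifted k + β (suc d) * multichoose (suc (d ∸ d)) k)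
      ≡⟨ sym (ℕP.+-assoc (solution (suc k) d) (shifted k) _) ⟩
    (solution (suc k) d + shifted k) + β (suc d) * multichoose (suc (d ∸ d)) k
      ≡⟨ cong₂ _+_ merge (cong (β (suc d) *_) last) ⟩
    shifted (suc k) + β (suc d) * multichoose (suc (d ∸ d)) (suc k) ∎
    where
    shifted : ℕ → ℕ
    shifted j = sumBelow (suc d) λ p → β p * multichoose (suc (suc d ∸ p)) j
    merge : solution (suc k) d + shifted k ≡ shifted (suc k)
    merge = begin
      solution (suc k) d + shifted k
        ≡⟨ sym (sumBelow-+ (suc d) _ _) ⟩
      sumBelow (suc d) (λ p → β p * multichoose (suc (d ∸ p)) (suc k) + β p * multichoose (suc (suc d ∸ p)) k)
        ≡⟨ sumBelow-cong (suc d) (λ p p≤d → trans (sym (ℕP.*-distribˡ-+ (β p) _ _))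
                                               (cong (β p *_) (sym (pascal-term k d p (s≤s⁻¹ p≤d))))) ⟩
      shifted (suc k) ∎
    last : multichoose (suc (d ∸ d)) k ≡ multichoose (suc (d ∸ d)) (suc k)
    last rewrite ℕP.n∸n≡0 d = trans (multichoose-1 k) (sym (multichoose-1 (suc k)))

  T-solution : ∀ k d → d ≤ n → T (n + k) (d + k) ≡ solution k d
  T-solution zero d d≤n = begin
    T (n + 0) (d + 0)   ≡⟨ cong₂ T (ℕP.+-identityʳ n) (ℕP.+-identityʳ d) ⟩
    T n d               ≡⟨ T-base d d≤n ⟩
    sumBelow (suc d) β  ≡⟨ sumBelow-cong (suc d) (λ p _ → sym (ℕP.*-identityʳ (β p))) ⟩
    solution 0 d        ∎
  T-solution (suc k) d d≤n = begin
    T (n + suc k) (d + suc k)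
      ≡⟨ cong₂ T (ℕP.+-suc n k) (ℕP.+-suc d k) ⟩
    T (suc (n + k)) (suc (d + k))
      ≡⟨ T-suc (n + k) (suc (d + k)) (ℕP.m≤m+n n k) (s≤s (ℕP.+-monoˡ-≤ k d≤n)) ⟩
    sumBelow (suc d + k) (T (n + k))
      ≡⟨ cong (λ h → sumBelow h (T (n + k))) (ℕP.+-comm (suc d) k) ⟩
    sumBelow (k + suc d) (T (n + k))
      ≡⟨ sumBelow-++ k (suc d) (T (n + k)) ⟩
    sumBelow k (T (n + k)) + sumBelow (suc d) (λ i → T (n + k) (k + i))
      ≡⟨ cong₂ _+_ (sumBelow-0 k (T-vanishes k))
                   (sumBelow-cong (suc d) λ i i≤d → trans (cong (T (n + k)) (ℕP.+-comm k i))
                                                          (T-solution k i (ℕP.≤-trans (s≤s⁻¹ i≤d) d≤n))) ⟩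
    sumBelow (suc d) (solution k)
      ≡⟨ solution-suc k d ⟩
    solution (suc k) d ∎

module _ {A : Set} {P Q : Pred A 0ℓ} (P? : Decidable P) (Q? : Decidable Q) where
  length-filter-∩-∁ : ∀ xs →
    length (filter P? xs) ≡ length (filter (P? ∩? Q?) xs) + length (filter (P? ∩? ∁? Q?) xs)
  length-filter-∩-∁ []       = refl
  length-filter-∩-∁ (x ∷ xs) with P? x | Q? x
  ... | yes _ | yes _ = cong suc (length-filter-∩-∁ xs)
  ... | yes _ | no  _ = trans (cong suc (length-filter-∩-∁ xs)) (sym (ℕP.+-suc _ _))
  ... | no  _ | _     = length-filter-∩-∁ xs

length-filter-partition : ∀ {A : Set} {P : Pred A 0ℓ} {R : ℕ → Pred A 0ℓ}
  (P? : Decidable P) (R? : ∀ p → Decidable (R p)) B →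
  (∀ {x} → P x → ∃[ p ] p < B × R p x) →
  (∀ {x p q} → p < B → q < B → P x → R p x → R q x → p ≡ q) → ∀ xs →
  length (filter P? xs) ≡ sumBelow B (λ p → length (filter (P? ∩? R? p) xs))
length-filter-partition P? R? zero cover _ xs =
  cong length (LP.filter-none P? (All.universal (λ _ Px → ℕP.n≮0 (proj₁ (proj₂ (cover Px)))) xs))
length-filter-partition {P = P} {R} P? R? (suc B) cover unique xs = begin
  length (filter P? xs)
    ≡⟨ length-filter-∩-∁ P? (R? B) xs ⟩
  #R B + length (filter P∖R? xs)
    ≡⟨ ℕP.+-comm (#R B) _ ⟩
  length (filter P∖R? xs) + #R B
    ≡⟨ cong (_+ #R B) (length-filter-partition P∖R? R? B cover′ unique′ xs) ⟩
  sumBelow B (λ p → length (filter (P∖R? ∩? R? p) xs)) + #R B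
    ≡⟨ cong (_+ #R B) (sumBelow-cong B λ p p<B →
         cong length (LP.filter-≐ (P∖R? ∩? R? p) (P? ∩? R? p) (drop-∁ p<B) xs)) ⟩
  sumBelow (suc B) #R ∎
  where
  #R : ℕ → ℕ
  #R p = length (filter (P? ∩? R? p) xs)
  P∖R? : Decidable (P ∩ ∁ (R B))
  P∖R? = P? ∩? ∁? (R? B)
  cover′ : ∀ {x} → (P ∩ ∁ (R B)) x → ∃[ p ] p < B × R p x
  cover′ (Px , ¬RBx) with p , p<1+B , Rpx ← cover Px =
    p , ℕP.≤∧≢⇒< (s≤s⁻¹ p<1+B) (λ { refl → ¬RBx Rpx }) , Rpx
  unique′ : ∀ {x p q} → p < B → q < B → (P ∩ ∁ (R B)) x → R p x → R q x → p ≡ q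
  unique′ p<B q<B (Px , _) = unique (ℕP.m<n⇒m<1+n p<B) (ℕP.m<n⇒m<1+n q<B) Px
  drop-∁ : ∀ {p} → p < B → (P ∩ ∁ (R B)) ∩ R p ≐ P ∩ R p
  drop-∁ p<B = (λ ((Px , _) , Rpx) → Px , Rpx)
             , (λ (Px , Rpx) → (Px , λ RBx →
                  ℕP.<-irrefl (unique (ℕP.m<n⇒m<1+n p<B) (ℕP.n<1+n B) Px Rpx RBx) p<B) , Rpx)

module _ {A B : Set} {P : Pred A 0ℓ} {Q : Pred B 0ℓ} (P? : Decidable P) (Q? : Decidable Q) where
  length-filter-bijection : ∀ {xs ys} → Unique xs → Unique ys → (∀ x → x ∈ xs) → (∀ y → y ∈ ys) →
    (f : A → B) → (∀ {x x′} → f x ≡ f x′ → x ≡ x′) → (∀ {x} → P x → Q (f x)) →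
    (∀ {y} → Q y → ∃[ x ] P x × f x ≡ y) →
    length (filter P? xs) ≡ length (filter Q? ys)
  length-filter-bijection {xs} {ys} xs! ys! ∈xs ∈ys f f-inj f-maps f-onto = begin
    length (filter P? xs)
      ≡⟨ sym (LP.length-map f (filter P? xs)) ⟩
    length (L.map f (filter P? xs))
      ≡⟨ ↭-length (∼bag⇒↭ (unique∧set⇒bag image! (Unique.filter⁺ Q? ys!) image≈)) ⟩
    length (filter Q? ys) ∎
    where
    image! : Unique (L.map f (filter P? xs))
    image! = Unique.map⁺ f-inj (Unique.filter⁺ P? xs!)
    to : ∀ {y} → y ∈ L.map f (filter P? xs) → y ∈ filter Q? ys
    to y∈ with x , x∈ , refl ← ∈.∈-map⁻ f y∈ =
      ∈.∈-filter⁺ Q? (∈ys _) (f-maps (proj₂ (∈.∈-filter⁻ P? {xs = xs} x∈)))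
    from : ∀ {y} → y ∈ filter Q? ys → y ∈ L.map f (filter P? xs)
    from y∈ with x , Px , refl ← f-onto (proj₂ (∈.∈-filter⁻ Q? {xs = ys} y∈)) =
      ∈.∈-map⁺ f (∈.∈-filter⁺ P? (∈xs x) Px)
    image≈ : L.map f (filter P? xs) ∼[ set ] filter Q? ys
    image≈ = mk⇔ to from

concatMap-map : ∀ {A B C : Set} (f : A → B → C) (xs : List A) (ys : List B) →
  concatMap (λ x → L.map (f x) ys) xs ≡ cartesianProductWith f xs ys
concatMap-map f []       ys = refl
concatMap-map f (x ∷ xs) ys = cong (L.map (f x) ys L.++_) (concatMap-map f xs ys)

allWords-complete : ∀ {m N} (v : Vec (Fin N) m) → v ∈ allWords m N
allWords-complete V.[]                  = here refl
allWords-complete {suc m} {N} (x V.∷ v) rewrite concatMap-map V._∷_ (L.allFin N) (allWords m N) =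
  ∈.∈-cartesianProductWith⁺ V._∷_ (∈.∈-allFin x) (allWords-complete v)

allWords-unique : ∀ m N → Unique (allWords m N)
allWords-unique zero    N = All.[] ∷ []
allWords-unique (suc m) N rewrite concatMap-map V._∷_ (L.allFin N) (allWords m N) =
  Unique.cartesianProductWith⁺ V._∷_ VP.∷-injective (Unique.allFin⁺ N) (allWords-unique m N)

count : ∀ {M N} {P : Pred (Vec (Fin N) M) 0ℓ} → Decidable P → ℕ
count {M} {N} P? = length (filter P? (allWords M N))

count-cong : ∀ {M N} {P Q : Pred (Vec (Fin N) M) 0ℓ} (P? : Decidable P) (Q? : Decidable Q) →
  P ≐ Q → count P? ≡ count Q?
count-cong {M} {N} P? Q? P≐Q = cong length (LP.filter-≐ P? Q? P≐Q (allWords M N))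

count-∅ : ∀ {M N} {P : Pred (Vec (Fin N) M) 0ℓ} (P? : Decidable P) → (∀ v → ¬ P v) → count P? ≡ 0
count-∅ {M} {N} P? empty = cong length (LP.filter-none P? (All.universal empty (allWords M N)))

count-bijection : ∀ {M N M′ N′} {P : Pred (Vec (Fin N) M) 0ℓ} {Q : Pred (Vec (Fin N′) M′) 0ℓ}
  (P? : Decidable P) (Q? : Decidable Q) (f : Vec (Fin N) M → Vec (Fin N′) M′) →
  (∀ {v v′} → f v ≡ f v′ → v ≡ v′) → (∀ {v} → P v → Q (f v)) →
  (∀ {w} → Q w → ∃[ v ] P v × f v ≡ w) → count P? ≡ count Q?
count-bijection {M} {N} {M′} {N′} P? Q? = length-filter-bijection P? Q?
  (allWords-unique M N) (allWords-unique M′ N′) allWords-complete allWords-complete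

clamp : ∀ N → ℕ → Fin (suc N)
clamp zero    _       = F.zero
clamp (suc N) zero    = F.zero
clamp (suc N) (suc p) = F.suc (clamp N p)

toℕ-clamp : ∀ {N p} → p ≤ N → toℕ (clamp N p) ≡ p
toℕ-clamp {zero}  z≤n       = refl
toℕ-clamp {suc N} z≤n       = refl
toℕ-clamp {suc N} (s≤s p≤N) = cong suc (toℕ-clamp p≤N)

clamp-toℕ : ∀ {N} (i : Fin (suc N)) → clamp N (toℕ i) ≡ i
clamp-toℕ i = FP.toℕ-injective (toℕ-clamp (s≤s⁻¹ (FP.toℕ<n i)))

punchIn-mono-< : ∀ {n} (i : Fin (suc n)) (j k : Fin n) → j F.< k → punchIn i j F.< punchIn i k
punchIn-mono-< F.zero    j         k         j<k       = s≤s j<k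
punchIn-mono-< (F.suc i) F.zero    (F.suc k) _         = s≤s z≤n
punchIn-mono-< (F.suc i) (F.suc j) (F.suc k) (s≤s j<k) = s≤s (punchIn-mono-< i j k j<k)

punchIn-cancel-< : ∀ {n} (i : Fin (suc n)) (j k : Fin n) → punchIn i j F.< punchIn i k → j F.< k
punchIn-cancel-< F.zero    j         k         (s≤s j<k) = j<k
punchIn-cancel-< (F.suc i) F.zero    (F.suc k) _         = s≤s z≤n
punchIn-cancel-< (F.suc i) (F.suc j) (F.suc k) (s≤s lt)  = s≤s (punchIn-cancel-< i j k lt)

i<punchIn : ∀ {n} (i : Fin (suc n)) (j : Fin n) → toℕ i ≤ toℕ j → i F.< punchIn i j
i<punchIn F.zero    j         _         = s≤s z≤n
i<punchIn (F.suc i) (F.suc j) (s≤s i≤j) = s≤s (i<punchIn i j i≤j)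

i<punchIn⁻ : ∀ {n} (i : Fin (suc n)) (j : Fin n) → i F.< punchIn i j → toℕ i ≤ toℕ j
i<punchIn⁻ F.zero    j         _        = z≤n
i<punchIn⁻ (F.suc i) (F.suc j) (s≤s lt) = s≤s (i<punchIn⁻ i j lt)

toℕ-punchIn-< : ∀ {n} (i : Fin (suc n)) (j : Fin n) → toℕ j < toℕ i → toℕ (punchIn i j) ≡ toℕ j
toℕ-punchIn-< (F.suc i) F.zero    _         = refl
toℕ-punchIn-< (F.suc i) (F.suc j) (s≤s j<i) = cong suc (toℕ-punchIn-< i j j<i)

data PunchInView {n} (i : Fin (suc n)) : Fin (suc n) → Set where
  pivot : PunchInView i i
  other : (j : Fin n) → PunchInView i (punchIn i j)

punchInView : ∀ {n} (i k : Fin (suc n)) → PunchInView i k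
punchInView i k with i F.≟ k
... | yes refl = pivot
... | no  i≢k  = subst (PunchInView i) (FP.punchIn-punchOut i≢k) (other (F.punchOut i≢k))

IncreasingFrom : ∀ {N} → ℕ → Vec (Fin N) N → Set
IncreasingFrom h v = ∀ a b → h ≤ toℕ a → a F.< b → ¬ (lookup v b F.< lookup v a)

increasingFrom? : ∀ {N} h → Decidable (IncreasingFrom {N} h)
increasingFrom? h v = FP.all? λ a → FP.all? λ b →
  (h ℕP.≤? toℕ a) →-dec (a FP.<? b) →-dec ¬? (lookup v b FP.<? lookup v a)

-- Values are 0-based as in Defs, so the large entries n + 1, …, N are those with toℕ ≥ n.
LargeBefore : ℕ → ℕ → ∀ {N} → Vec (Fin N) N → Set
LargeBefore n h v = ∀ a → n ≤ toℕ (lookup v a) → toℕ a < h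

largeBefore? : ∀ n h {N} → Decidable (LargeBefore n h {N})
largeBefore? n h v = FP.all? λ a → (n ℕP.≤? toℕ (lookup v a)) →-dec (toℕ a ℕP.<? h)

Refined : ℕ → ℕ → ∀ {N} → Vec (Fin N) N → Set
Refined n h v = Avoids321 v × LargestAreLTRMax n v × IncreasingFrom h v × LargeBefore n h v

refined? : ∀ n h {N} → Decidable (Refined n h {N})
refined? n h = avoids321? ∩? largestAreLTRMax? n ∩? increasingFrom? h ∩? largeBefore? n h

insertMax : ∀ {N} → Vec (Fin N) N → Fin (suc N) → Vec (Fin (suc N)) (suc N)
insertMax {N} σ i = V.insertAt (V.map inject₁ σ) i (fromℕ N)

module _ {N} (σ : Vec (Fin N) N) (i : Fin (suc N)) where
  private
    τ : Vec (Fin (suc N)) (suc N)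
    τ = insertMax σ i

  lookup-insertMax-pivot : lookup τ i ≡ fromℕ N
  lookup-insertMax-pivot = VP.insertAt-lookup (V.map inject₁ σ) i (fromℕ N)

  lookup-insertMax-punchIn : ∀ j → lookup τ (punchIn i j) ≡ inject₁ (lookup σ j)
  lookup-insertMax-punchIn j =
    trans (VP.insertAt-punchIn (V.map inject₁ σ) i (fromℕ N) j) (VP.lookup-map j inject₁ σ)

  toℕ-insertMax-pivot : toℕ (lookup τ i) ≡ N
  toℕ-insertMax-pivot = trans (cong toℕ lookup-insertMax-pivot) (FP.toℕ-fromℕ N)

  toℕ-insertMax-punchIn : ∀ j → toℕ (lookup τ (punchIn i j)) ≡ toℕ (lookup σ j)
  toℕ-insertMax-punchIn j = trans (cong toℕ (lookup-insertMax-punchIn j)) (FP.toℕ-inject₁ (lookup σ j))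

  insertMax-punchIn<pivot : ∀ j → lookup τ (punchIn i j) F.< lookup τ i
  insertMax-punchIn<pivot j =
    subst₂ _<_ (sym (toℕ-insertMax-punchIn j)) (sym toℕ-insertMax-pivot) (FP.toℕ<n (lookup σ j))

  insertMax-pivot-maximal : ∀ k → ¬ (lookup τ i F.< lookup τ k)
  insertMax-pivot-maximal k lt = ℕP.<⇒≱ lt
    (subst (toℕ (lookup τ k) ≤_) (sym toℕ-insertMax-pivot) (s≤s⁻¹ (FP.toℕ<n (lookup τ k))))

  insertMax-<-punchIn : ∀ j k → lookup τ (punchIn i j) F.< lookup τ (punchIn i k) → lookup σ j F.< lookup σ k
  insertMax-<-punchIn j k = subst₂ _<_ (toℕ-insertMax-punchIn j) (toℕ-insertMax-punchIn k)

  insertMax-<-punchIn⁻ : ∀ j k → lookup σ j F.< lookup σ k → lookup τ (punchIn i j) F.< lookup τ (punchIn i k)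
  insertMax-<-punchIn⁻ j k = subst₂ _<_ (sym (toℕ-insertMax-punchIn j)) (sym (toℕ-insertMax-punchIn k))

  insertMax-isPerm : IsPerm σ → IsPerm τ
  insertMax-isPerm σ-inj k k′ eq with punchInView i k | punchInView i k′
  ... | pivot   | pivot    = refl
  ... | pivot   | other j′ = ⊥-elim (FP.<⇒≢ (insertMax-punchIn<pivot j′) (sym eq))
  ... | other j | pivot    = ⊥-elim (FP.<⇒≢ (insertMax-punchIn<pivot j) eq)
  ... | other j | other j′ = cong (punchIn i) (σ-inj j j′ (FP.inject₁-injective (begin
    inject₁ (lookup σ j)    ≡⟨ sym (lookup-insertMax-punchIn j) ⟩
    lookup τ (punchIn i j)  ≡⟨ eq ⟩
    lookup τ (punchIn i j′) ≡⟨ lookup-insertMax-punchIn j′ ⟩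
    inject₁ (lookup σ j′)   ∎)))

  insertMax-isPerm⁻ : IsPerm τ → IsPerm σ
  insertMax-isPerm⁻ τ-inj j j′ eq = FP.punchIn-injective i j j′ (τ-inj _ _ (begin
    lookup τ (punchIn i j)  ≡⟨ lookup-insertMax-punchIn j ⟩
    inject₁ (lookup σ j)    ≡⟨ cong inject₁ eq ⟩
    inject₁ (lookup σ j′)   ≡⟨ sym (lookup-insertMax-punchIn j′) ⟩
    lookup τ (punchIn i j′) ∎))

  avoids321-insertMax : Avoids321 σ → IncreasingFrom (toℕ i) σ → Avoids321 τ
  avoids321-insertMax avoids inc a b c a<b b<c (cb , ba)
    with punchInView i a | punchInView i b | punchInView i c
  ... | _        | pivot    | _        = insertMax-pivot-maximal a ba
  ... | _        | other _  | pivot    = insertMax-pivot-maximal b cb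
  ... | pivot    | other b′ | other c′ =
    inc b′ c′ (i<punchIn⁻ i b′ a<b) (punchIn-cancel-< i b′ c′ b<c) (insertMax-<-punchIn c′ b′ cb)
  ... | other a′ | other b′ | other c′ =
    avoids a′ b′ c′ (punchIn-cancel-< i a′ b′ a<b) (punchIn-cancel-< i b′ c′ b<c)
      (insertMax-<-punchIn c′ b′ cb , insertMax-<-punchIn b′ a′ ba)

  avoids321-insertMax⁻ : Avoids321 τ → Avoids321 σ × IncreasingFrom (toℕ i) σ
  avoids321-insertMax⁻ avoids =
      (λ a b c a<b b<c (cb , ba) →
         avoids (punchIn i a) (punchIn i b) (punchIn i c) (punchIn-mono-< i a b a<b) (punchIn-mono-< i b c b<c)
           (insertMax-<-punchIn⁻ c b cb , insertMax-<-punchIn⁻ b a ba))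
    , (λ a b i≤a a<b ba →
         avoids i (punchIn i a) (punchIn i b) (i<punchIn i a i≤a) (punchIn-mono-< i a b a<b)
           (insertMax-<-punchIn⁻ b a ba , insertMax-punchIn<pivot a))

  largestAreLTRMax-insertMax : ∀ n → LargestAreLTRMax n σ → LargeBefore n (toℕ i) σ → LargestAreLTRMax n τ
  largestAreLTRMax-insertMax n ltr before k n≤τk l l<k with punchInView i k | punchInView i l
  ... | pivot    | pivot    = ⊥-elim (ℕP.<-irrefl refl l<k)
  ... | pivot    | other l′ = insertMax-punchIn<pivot l′
  ... | other k′ | pivot    = ⊥-elim (ℕP.<⇒≱ (before k′ (subst (n ≤_) (toℕ-insertMax-punchIn k′) n≤τk))
                                              (i<punchIn⁻ i k′ l<k))
  ... | other k′ | other l′ = insertMax-<-punchIn⁻ l′ k′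
    (ltr k′ (subst (n ≤_) (toℕ-insertMax-punchIn k′) n≤τk) l′ (punchIn-cancel-< i l′ k′ l<k))

  largestAreLTRMax-insertMax⁻ : ∀ n → LargestAreLTRMax n τ → LargestAreLTRMax n σ × LargeBefore n (toℕ i) σ
  largestAreLTRMax-insertMax⁻ n ltr =
      (λ k n≤σk l l<k → insertMax-<-punchIn l k
         (ltr (punchIn i k) (large k n≤σk) (punchIn i l) (punchIn-mono-< i l k l<k)))
    , (λ k n≤σk → ℕP.≰⇒> λ i≤k → insertMax-pivot-maximal (punchIn i k)
         (ltr (punchIn i k) (large k n≤σk) i (i<punchIn i k i≤k)))
    where
    large : ∀ k → n ≤ toℕ (lookup σ k) → n ≤ toℕ (lookup τ (punchIn i k))
    large k = subst (n ≤_) (sym (toℕ-insertMax-punchIn k))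

  increasingFrom-insertMax : ∀ h → IncreasingFrom (toℕ i) σ → toℕ i < h → IncreasingFrom h τ
  increasingFrom-insertMax h inc i<h a b h≤a a<b ba with punchInView i a | punchInView i b
  ... | _        | pivot    = insertMax-pivot-maximal a ba
  ... | pivot    | _        = ℕP.<-irrefl refl (ℕP.<-≤-trans i<h h≤a)
  ... | other a′ | other b′ = inc a′ b′ (i<punchIn⁻ i a′ (ℕP.<-≤-trans i<h h≤a)) (punchIn-cancel-< i a′ b′ a<b)
    (insertMax-<-punchIn b′ a′ ba)

  increasingFrom-insertMax⇒last : ∀ h → IncreasingFrom h τ → h ≤ toℕ i → toℕ i ≡ N
  increasingFrom-insertMax⇒last h inc h≤i with ℕP.m≤n⇒m<n∨m≡n (s≤s⁻¹ (FP.toℕ<n i))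
  ... | inj₂ i≡N = i≡N
  ... | inj₁ i<N = ⊥-elim (inc i (punchIn i j) h≤i (i<punchIn i j (ℕP.≤-reflexive (sym (FP.toℕ-fromℕ< i<N))))
                             (insertMax-punchIn<pivot j))
    where
    j : Fin N
    j = F.fromℕ< i<N

  module _ (i≡N : toℕ i ≡ N) where
    private
      toℕ-punchIn : ∀ j → toℕ (punchIn i j) ≡ toℕ j
      toℕ-punchIn j = toℕ-punchIn-< i j (subst (toℕ j <_) (sym i≡N) (FP.toℕ<n j))

    increasingFrom-insertMaxLast : ∀ h → IncreasingFrom h σ → IncreasingFrom h τ
    increasingFrom-insertMaxLast h inc a b h≤a a<b ba with punchInView i a | punchInView i b
    ... | _        | pivot    = insertMax-pivot-maximal a ba
    ... | pivot    | other b′ = ℕP.<-asym a<b (subst₂ _<_ (sym (toℕ-punchIn b′)) (sym i≡N) (FP.toℕ<n b′))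
    ... | other a′ | other b′ = inc a′ b′ (subst (h ≤_) (toℕ-punchIn a′) h≤a) (punchIn-cancel-< i a′ b′ a<b)
      (insertMax-<-punchIn b′ a′ ba)

    increasingFrom-insertMaxLast⁻ : ∀ h → IncreasingFrom h τ → IncreasingFrom h σ
    increasingFrom-insertMaxLast⁻ h inc a b h≤a a<b ba = inc (punchIn i a) (punchIn i b)
      (subst (h ≤_) (sym (toℕ-punchIn a)) h≤a) (punchIn-mono-< i a b a<b) (insertMax-<-punchIn⁻ b a ba)

  largeBefore-insertMax : ∀ n h → LargeBefore n (toℕ i) σ → toℕ i < h → LargeBefore n h τ
  largeBefore-insertMax n h before i<h k n≤τk with punchInView i k
  ... | pivot    = i<h
  ... | other k′ = let k′<i = before k′ (subst (n ≤_) (toℕ-insertMax-punchIn k′) n≤τk) in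
    subst (_< h) (sym (toℕ-punchIn-< i k′ k′<i)) (ℕP.<-trans k′<i i<h)

  largeBefore-insertMax⇒< : ∀ n h → n ≤ N → LargeBefore n h τ → toℕ i < h
  largeBefore-insertMax⇒< n h n≤N before = before i (subst (n ≤_) (sym toℕ-insertMax-pivot) n≤N)

  refined-insertMax : ∀ n h → toℕ i < h → Refined n (toℕ i) σ → Refined n h τ
  refined-insertMax n h i<h (avoids , ltr , inc , before) =
      avoids321-insertMax avoids inc , largestAreLTRMax-insertMax n ltr before
    , increasingFrom-insertMax h inc i<h , largeBefore-insertMax n h before i<h

  refined-insertMax⁻ : ∀ n h → Refined n h τ → Refined n (toℕ i) σ
  refined-insertMax⁻ n h (avoids , ltr , _) =
    let avoids′ , inc    = avoids321-insertMax⁻ avoids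
        ltr′    , before = largestAreLTRMax-insertMax⁻ n ltr
    in avoids′ , ltr′ , inc , before

insertMax-injective : ∀ {N} {σ σ′ : Vec (Fin N) N} i → insertMax σ i ≡ insertMax σ′ i → σ ≡ σ′
insertMax-injective {σ = σ} {σ′} i eq = Pointwise-≡⇒≡ (ext λ j → FP.inject₁-injective (begin
  inject₁ (lookup σ j)                   ≡⟨ sym (lookup-insertMax-punchIn σ i j) ⟩
  lookup (insertMax σ i) (punchIn i j)   ≡⟨ cong (λ τ → lookup τ (punchIn i j)) eq ⟩
  lookup (insertMax σ′ i) (punchIn i j)  ≡⟨ lookup-insertMax-punchIn σ′ i j ⟩
  inject₁ (lookup σ′ j)                  ∎))

insertMax-surjective : ∀ {N} (τ : Vec (Fin (suc N)) (suc N)) i → IsPerm τ → lookup τ i ≡ fromℕ N →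
  ∃[ σ ] insertMax σ i ≡ τ
insertMax-surjective {N} τ i τ-inj τi≡N = σ , (begin
  V.insertAt (V.map inject₁ σ) i (fromℕ N)
    ≡⟨ cong₂ (λ xs x → V.insertAt xs i x) map-inject₁-σ (sym τi≡N) ⟩
  V.insertAt (V.removeAt τ i) i (lookup τ i)
    ≡⟨ VP.insertAt-removeAt τ i ⟩
  τ ∎)
  where
  rest : Vec (Fin (suc N)) N
  rest = V.removeAt τ i
  lookup-rest : ∀ j → lookup rest j ≡ lookup τ (punchIn i j)
  lookup-rest j = trans (cong (lookup rest) (sym (FP.punchOut-punchIn i)))
    (VP.removeAt-punchOut τ (FP.punchInᵢ≢i i j ∘ sym))
  below-top : ∀ j → N ≢ toℕ (lookup rest j)
  below-top j N≡ = FP.punchInᵢ≢i i j (τ-inj _ _ (begin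
    lookup τ (punchIn i j)  ≡⟨ sym (lookup-rest j) ⟩
    lookup rest j           ≡⟨ FP.toℕ-injective (trans (sym N≡) (sym (FP.toℕ-fromℕ N))) ⟩
    fromℕ N                 ≡⟨ sym τi≡N ⟩
    lookup τ i              ∎))
  σ : Vec (Fin N) N
  σ = tabulate λ j → lower₁ (lookup rest j) (below-top j)
  map-inject₁-σ : V.map inject₁ σ ≡ rest
  map-inject₁-σ = begin
    V.map inject₁ σ
      ≡⟨ sym (VP.tabulate-∘ inject₁ _) ⟩
    tabulate (λ j → inject₁ (lower₁ (lookup rest j) (below-top j)))
      ≡⟨ VP.tabulate-cong (λ j → FP.inject₁-lower₁ (lookup rest j) (below-top j)) ⟩
    tabulate (lookup rest)
      ≡⟨ VP.tabulate∘lookup rest ⟩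
    rest ∎

TopAt : ∀ {N} → Fin (suc N) → Vec (Fin (suc N)) (suc N) → Set
TopAt {N} i τ = lookup τ i ≡ fromℕ N

topAt? : ∀ {N} (i : Fin (suc N)) → Decidable (TopAt i)
topAt? {N} i τ = lookup τ i F.≟ fromℕ N

isPerm⇒hasTop : ∀ {N} (τ : Vec (Fin (suc N)) (suc N)) → IsPerm τ → ∃[ i ] TopAt i τ
isPerm⇒hasTop {N} τ τ-inj with FP.any? (λ i → topAt? i τ)
... | yes top = top
... | no ¬top = ⊥-elim (ℕP.1+n≰n (FP.injective⇒≤ lowered-injective))
  where
  below : ∀ i → N ≢ toℕ (lookup τ i)
  below i N≡ = ¬top (i , FP.toℕ-injective (trans (sym N≡) (sym (FP.toℕ-fromℕ N))))
  lowered-injective : Injective _≡_ _≡_ (λ i → lower₁ (lookup τ i) (below i))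
  lowered-injective eq = τ-inj _ _ (FP.lower₁-injective eq)

count-insertMax : ∀ {N} (i : Fin (suc N)) {Q : Pred (Vec (Fin (suc N)) (suc N)) 0ℓ} (Q? : Decidable Q) →
  count ((isPerm? ∩? Q?) ∩? topAt? i) ≡ count (isPerm? ∩? (Q? ∘ λ σ → insertMax σ i))
count-insertMax i {Q} Q? = sym (count-bijection
  (isPerm? ∩? (Q? ∘ λ σ → insertMax σ i)) ((isPerm? ∩? Q?) ∩? topAt? i) (λ σ → insertMax σ i)
  (insertMax-injective i)
  (λ {σ} (σ-perm , Qτ) → (insertMax-isPerm σ i σ-perm , Qτ) , lookup-insertMax-pivot σ i)
  λ {τ} ((τ-perm , Qτ) , top) → let σ , σ↦τ = insertMax-surjective τ i τ-perm top in
    σ , (insertMax-isPerm⁻ σ i (subst IsPerm (sym σ↦τ) τ-perm) , subst Q (sym σ↦τ) Qτ) , σ↦τ)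

count-byTop : ∀ {N} {Q : Pred (Vec (Fin (suc N)) (suc N)) 0ℓ} (Q? : Decidable Q) →
  count (isPerm? ∩? Q?) ≡ sumBelow (suc N) (λ p → count (isPerm? ∩? (Q? ∘ λ σ → insertMax σ (clamp N p))))
count-byTop {N} {Q} Q? = trans
  (length-filter-partition (isPerm? ∩? Q?) (topAt? ∘ clamp N) (suc N) cover unique (allWords (suc N) (suc N)))
  (sumBelow-cong (suc N) λ p _ → count-insertMax (clamp N p) Q?)
  where
  cover : ∀ {τ} → (IsPerm ∩ Q) τ → ∃[ p ] p < suc N × TopAt (clamp N p) τ
  cover {τ} (τ-perm , _) with i , top ← isPerm⇒hasTop τ τ-perm =
    toℕ i , FP.toℕ<n i , subst (λ j → TopAt j τ) (sym (clamp-toℕ i)) top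
  unique : ∀ {τ p q} → p < suc N → q < suc N → (IsPerm ∩ Q) τ →
    TopAt (clamp N p) τ → TopAt (clamp N q) τ → p ≡ q
  unique {τ} {p} {q} p<1+N q<1+N (τ-perm , _) top top′ = begin
    p                ≡⟨ sym (toℕ-clamp (s≤s⁻¹ p<1+N)) ⟩
    toℕ (clamp N p)  ≡⟨ cong toℕ (τ-perm _ _ (trans top (sym top′))) ⟩
    toℕ (clamp N q)  ≡⟨ toℕ-clamp (s≤s⁻¹ q<1+N) ⟩
    q                ∎

countRefined : ℕ → ℕ → ℕ → ℕ
countRefined n N h = count (isPerm? ∩? refined? n h {N})

insertedRefined? : ∀ n h N p →
  Decidable (λ (σ : Vec (Fin N) N) → IsPerm σ × Refined n h (insertMax σ (clamp N p)))
insertedRefined? n h N p = isPerm? ∩? (refined? n h ∘ λ σ → insertMax σ (clamp N p))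

countRefined-byTop : ∀ n N h → countRefined n (suc N) h ≡ sumBelow (suc N) (count ∘ insertedRefined? n h N)
countRefined-byTop n N h = count-byTop {N} (refined? n h)

countRefined-suc : ∀ n N h → n ≤ N → h ≤ suc N → countRefined n (suc N) h ≡ sumBelow h (countRefined n N)
countRefined-suc n N h n≤N h≤1+N =
  trans (countRefined-byTop n N h) (sumBelow-truncate h (suc N) h≤1+N before-h from-h)
  where
  before-h : ∀ p → p < h → count (insertedRefined? n h N p) ≡ countRefined n N p
  before-h p p<h = count-cong (insertedRefined? n h N p) (isPerm? ∩? refined? n p)
      ( (λ {σ} (σ-perm , ref) → σ-perm , subst (λ q → Refined n q σ) i≡p (refined-insertMax⁻ σ i n h ref))
      , (λ {σ} (σ-perm , ref) → σ-perm , refined-insertMax σ i n h (subst (_< h) (sym i≡p) p<h)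
                                           (subst (λ q → Refined n q σ) (sym i≡p) ref)))
    where
    i : Fin (suc N)
    i = clamp N p
    i≡p : toℕ i ≡ p
    i≡p = toℕ-clamp (s≤s⁻¹ (ℕP.<-≤-trans p<h h≤1+N))
  from-h : ∀ p → h ≤ p → p < suc N → count (insertedRefined? n h N p) ≡ 0
  from-h p h≤p p<1+N = count-∅ (insertedRefined? n h N p) λ σ (_ , _ , _ , _ , before) →
    ℕP.<⇒≱ (largeBefore-insertMax⇒< σ (clamp N p) n h n≤N before)
      (subst (h ≤_) (sym (toℕ-clamp (s≤s⁻¹ p<1+N))) h≤p)

module _ {N} (v : Vec (Fin N) N) where
  largestAreLTRMax-none : LargestAreLTRMax N v
  largestAreLTRMax-none k N≤vk = ⊥-elim (ℕP.<⇒≱ (FP.toℕ<n (lookup v k)) N≤vk)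

  largeBefore-none : ∀ h → LargeBefore N h v
  largeBefore-none h k N≤vk = ⊥-elim (ℕP.<⇒≱ (FP.toℕ<n (lookup v k)) N≤vk)

  largeBefore-end : ∀ n → LargeBefore n N v
  largeBefore-end n k _ = FP.toℕ<n k

  increasingFrom-end : IncreasingFrom N v
  increasingFrom-end a _ N≤a = ⊥-elim (ℕP.<⇒≱ (FP.toℕ<n a) N≤a)

countLTR≡countRefined : ∀ n k → countLTR n k ≡ countRefined n (n + k) (n + k)
countLTR≡countRefined n k = count-cong
  (isPerm? ∩? avoids321? ∩? largestAreLTRMax? n) (isPerm? ∩? refined? n (n + k))
  ( (λ {v} (perm , avoids , ltr) → perm , avoids , ltr , increasingFrom-end v , largeBefore-end v n)
  , (λ (perm , avoids , ltr , _) → perm , avoids , ltr))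

module Base (m : ℕ) where
  private
    n : ℕ
    n = suc m

  countIncreasingFrom : ℕ → ℕ
  countIncreasingFrom p = count (isPerm? ∩? avoids321? ∩? increasingFrom? {m} p)

  b≡countIncreasingFrom : ∀ p → p ≤ m → b n (p + 1) ≡ countIncreasingFrom p
  b≡countIncreasingFrom p p≤m = begin
    b n (p + 1)
      ≡⟨ count-cong (isPerm? ∩? avoids321? ∩? maxAt? n (p + 1)) ((isPerm? ∩? avoids321?) ∩? topAt? i)
           ( (λ {τ} (perm , avoids , max) → (perm , avoids) , maxAt⇒topAt {τ} max)
           , (λ {τ} ((perm , avoids) , top) → perm , avoids , topAt⇒maxAt {τ} top)) ⟩
    count ((isPerm? ∩? avoids321?) ∩? topAt? i)
      ≡⟨ count-insertMax i avoids321? ⟩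
    count (isPerm? ∩? (avoids321? ∘ λ σ → insertMax σ i))
      ≡⟨ count-cong (isPerm? ∩? (avoids321? ∘ λ σ → insertMax σ i)) (isPerm? ∩? avoids321? ∩? increasingFrom? p)
           ( (λ {σ} (perm , avoids) → let avoids′ , inc = avoids321-insertMax⁻ σ i avoids in
                perm , avoids′ , subst (λ q → IncreasingFrom q σ) i≡p inc)
           , (λ {σ} (perm , avoids , inc) →
                perm , avoids321-insertMax σ i avoids (subst (λ q → IncreasingFrom q σ) (sym i≡p) inc))) ⟩
    countIncreasingFrom p ∎
    where
    i : Fin (suc m)
    i = clamp m p
    i≡p : toℕ i ≡ p
    i≡p = toℕ-clamp p≤m
    maxAt⇒topAt : ∀ {τ} → MaxAt n (p + 1) τ → TopAt i τ
    maxAt⇒topAt {τ} (q , q+1≡p+1 , τq+1≡n) = subst (λ j → TopAt j τ)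
      (FP.toℕ-injective (trans (ℕP.suc-injective (trans q+1≡p+1 (ℕP.+-comm p 1))) (sym i≡p)))
      (FP.toℕ-injective (trans (ℕP.suc-injective τq+1≡n) (sym (FP.toℕ-fromℕ m))))
    topAt⇒maxAt : ∀ {τ} → TopAt i τ → MaxAt n (p + 1) τ
    topAt⇒maxAt top =
      i , trans (cong suc i≡p) (ℕP.+-comm 1 p) , cong suc (trans (cong toℕ top) (FP.toℕ-fromℕ m))

  b-beyond : b n (n + 1) ≡ 0
  b-beyond = count-∅ (isPerm? ∩? avoids321? ∩? maxAt? n (n + 1)) λ _ (_ , _ , q , q+1≡n+1 , _) →
    ℕP.<-irrefl (ℕP.suc-injective (trans q+1≡n+1 (ℕP.+-comm n 1))) (FP.toℕ<n q)

  refined-noLarge : ∀ d (τ : Vec (Fin n) n) → Avoids321 τ → IncreasingFrom d τ → Refined n d τ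
  refined-noLarge d τ avoids inc = avoids , largestAreLTRMax-none τ , inc , largeBefore-none τ d

  countInserted : ℕ → ℕ → ℕ
  countInserted d = count ∘ insertedRefined? n d m

  module _ (d : ℕ) where
    countInserted-before : ∀ p → p < d → p ≤ m → countInserted d p ≡ countIncreasingFrom p
    countInserted-before p p<d p≤m =
      count-cong (insertedRefined? n d m p) (isPerm? ∩? avoids321? ∩? increasingFrom? p)
      ( (λ {σ} (perm , avoids , _) → let avoids′ , inc = avoids321-insertMax⁻ σ i avoids in
           perm , avoids′ , subst (λ q → IncreasingFrom q σ) i≡p inc)
      , (λ {σ} (perm , avoids , inc) → let inc′ = subst (λ q → IncreasingFrom q σ) (sym i≡p) inc in
           perm , refined-noLarge d (insertMax σ i) (avoids321-insertMax σ i avoids inc′)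
                    (increasingFrom-insertMax σ i d inc′ (subst (_< d) (sym i≡p) p<d))))
      where
      i : Fin (suc m)
      i = clamp m p
      i≡p : toℕ i ≡ p
      i≡p = toℕ-clamp p≤m

    countInserted-middle : ∀ p → d ≤ p → p < m → countInserted d p ≡ 0
    countInserted-middle p d≤p p<m = count-∅ (insertedRefined? n d m p) λ σ (_ , _ , _ , inc , _) →
      ℕP.<-irrefl (trans (sym i≡p) (increasingFrom-insertMax⇒last σ i d inc (subst (d ≤_) (sym i≡p) d≤p))) p<m
      where
      i : Fin (suc m)
      i = clamp m p
      i≡p : toℕ i ≡ p
      i≡p = toℕ-clamp (ℕP.<⇒≤ p<m)

    countInserted-last : d ≤ m → countInserted d m ≡ countIncreasingFrom d
    countInserted-last d≤m =
      count-cong (insertedRefined? n d m m) (isPerm? ∩? avoids321? ∩? increasingFrom? d)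
      ( (λ {σ} (perm , avoids , _ , inc , _) →
           perm , proj₁ (avoids321-insertMax⁻ σ i avoids) , increasingFrom-insertMaxLast⁻ σ i i≡m d inc)
      , (λ {σ} (perm , avoids , inc) → perm , refined-noLarge d (insertMax σ i)
           (avoids321-insertMax σ i avoids (subst (λ q → IncreasingFrom q σ) (sym i≡m) (increasingFrom-end σ)))
           (increasingFrom-insertMaxLast σ i i≡m d inc)))
      where
      i : Fin (suc m)
      i = clamp m m
      i≡m : toℕ i ≡ m
      i≡m = toℕ-clamp ℕP.≤-refl

  countRefined-base : ∀ d → d ≤ n → countRefined n n d ≡ sumBelow (suc d) (λ p → b n (p + 1))
  countRefined-base d d≤n with ℕP.m≤n⇒m<n∨m≡n d≤n
  ... | inj₁ d<n = begin
    countRefined n n d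
      ≡⟨ countRefined-byTop n m d ⟩
    sumBelow m (countInserted d) + countInserted d m
      ≡⟨ cong₂ _+_ (sumBelow-truncate d m d≤m
                      (λ p p<d → countInserted-before d p p<d (ℕP.≤-trans (ℕP.<⇒≤ p<d) d≤m))
                      (countInserted-middle d))
                   (countInserted-last d d≤m) ⟩
    sumBelow (suc d) countIncreasingFrom
      ≡⟨ sumBelow-cong (suc d) (λ p p≤d → sym (b≡countIncreasingFrom p (ℕP.≤-trans (s≤s⁻¹ p≤d) d≤m))) ⟩
    sumBelow (suc d) (λ p → b n (p + 1)) ∎
    where
    d≤m : d ≤ m
    d≤m = s≤s⁻¹ d<n
  ... | inj₂ refl = begin
    countRefined n n n
      ≡⟨ countRefined-byTop n m n ⟩
    sumBelow n (countInserted n)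
      ≡⟨ sumBelow-cong n (λ p p<n → trans (countInserted-before n p p<n (s≤s⁻¹ p<n))
                                         (sym (b≡countIncreasingFrom p (s≤s⁻¹ p<n)))) ⟩
    sumBelow n (λ p → b n (p + 1))
      ≡⟨ sym (trans (cong (sumBelow n (λ p → b n (p + 1)) +_) b-beyond) (ℕP.+-identityʳ _)) ⟩
    sumBelow (suc n) (λ p → b n (p + 1)) ∎

lemma4p15 : (n k : ℕ) → 1 ≤ n →
    countLTR n k ≡ sumBelow n (λ i → multichoose (n ∸ i + 1) k * b n (i + 1))
lemma4p15 (suc m) k _ = begin
  countLTR n k
    ≡⟨ countLTR≡countRefined n k ⟩
  countRefined n (n + k) (n + k)
    ≡⟨ T-solution k n ℕP.≤-refl ⟩
  sumBelow n term + b n (n + 1) * multichoose (suc (n ∸ n)) k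
    ≡⟨ cong (λ x → sumBelow n term + x * multichoose (suc (n ∸ n)) k) b-beyond ⟩
  sumBelow n term + 0
    ≡⟨ ℕP.+-identityʳ _ ⟩
  sumBelow n term
    ≡⟨ sumBelow-cong n (λ p _ → trans (ℕP.*-comm (b n (p + 1)) _)
                                     (cong (λ u → multichoose u k * b n (p + 1)) (ℕP.+-comm 1 (n ∸ p)))) ⟩
  sumBelow n (λ i → multichoose (n ∸ i + 1) k * b n (i + 1)) ∎
  where
  n : ℕ
  n = suc m
  term : ℕ → ℕ
  term p = b n (p + 1) * multichoose (suc (n ∸ p)) k
  open Base m using (countRefined-base; b-beyond)
  open Recurrence n (countRefined n) (λ p → b n (p + 1)) (countRefined-suc n) countRefined-base
    using (T-solution)
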